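{- Let $G_a$ and $G_b$ be permutation digraphs on $n$ vertices, each of degree $d$, arising from $a=(a_1,\dots,a_d)$ and $b=(b_1,\dots,b_d)$, such that for some $j\in[d]$ the permutations $a_j$ and $b_j$ are $n$-cycles, with vertices labeled so that $a_j(i)=b_j(i)=(i\bmod n)+1$ for all $i\in[n]$. Then there exists a color-isomorphism of $G_a$ onto $G_b$ if and only if the strings $\mathcal{S}^j(G_a)$ and $\mathcal{S}^j(G_b)$ are cyclically equivalent.
   Context: The permutation digraph $G_a$ has vertex set $[n]=\{1,\dots,n\}$ and arcs $(i,a_k)$, $i\in[n]$, $k\in[d]$; the arc $(i,a_k)$ goes from $i$ to $a_k(i)$ and has color $k$. A color-isomorphism of $G_a$ onto $G_b$ is a pair of bijections on vertices and on arcs preserving initial vertices, terminal vertices and colors of arcs. For each arc define $\sigma^j(i,a_k)=(a_k(i)-i)\bmod n$ if $k\neq j$ and $\sigma^j(i,a_j)=n$. For each vertex $i$ let $\Delta^j_i(G_a)$ be the string $\sigma^j(i,a_1)\sigma^j(i,a_2)\cdots\sigma^j(i,a_d)$ of length $d$ over the alphabet $\{0,1,\dots,n\}$ (each number is one character), and let $\mathcal{S}^j(G_a)=\Delta^j_1(G_a)\Delta^j_2(G_a)\cdots\Delta^j_n(G_a)$ (concatenation); similarly for $G_b$. Two strings $\kappa,\kappa'$ are cyclically equivalent if there are strings $x,y$ with $\kappa=xy$ and $\kappa'=yx$. -}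

module Defs where

open import Data.Nat using (ℕ; suc; _+_; _∸_; _%_; NonZero)
open import Data.Nat.DivMod using (_mod_)
open import Data.Fin using (Fin; toℕ)
open import Data.Fin.Permutation using (Permutation′; _⟨$⟩ʳ_)
open import Data.List using (List; map; concatMap; allFin; _++_)
open import Data.Product using (_×_; _,_; proj₁; proj₂; ∃₂)
open import Relation.Binary.PropositionalEquality using (_≡_)
open import Relation.Nullary using (Dec; yes; no)
open import Data.Fin using (_≟_)
open import Function.Bundles using (_↔_; Inverse)

-- Vertex i ∈ [n] is represented by (i - 1) : Fin n.
-- A family a = (a_1,…,a_d) of permutations of [n].
PermFamily : ℕ → ℕ → Set
PermFamily n d = Fin d → Permutation′ n

-- the n-cycle i ↦ (i mod n) + 1, in 0-based form: i ↦ (i + 1) mod n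
next : (n : ℕ) → .{{_ : NonZero n}} → Fin n → Fin n
next n i = suc (toℕ i) mod n

IsStdCycle : {n : ℕ} → .{{_ : NonZero n}} → Permutation′ n → Set
IsStdCycle {n} p = ∀ (i : Fin n) → p ⟨$⟩ʳ i ≡ next n i

-- Arcs of G_a: the arc (i, a_k) is represented by the pair (i , k).
Arc : ℕ → ℕ → Set
Arc n d = Fin n × Fin d

initV : ∀ {n d} → Arc n d → Fin n
initV = proj₁

termV : ∀ {n d} → PermFamily n d → Arc n d → Fin n
termV a (i , k) = a k ⟨$⟩ʳ i

colour : ∀ {n d} → Arc n d → Fin d
colour = proj₂

record ColorIso {n d : ℕ} (a b : PermFamily n d) : Set where
  field
    φ : Fin n ↔ Fin n
    ψ : Arc n d ↔ Arc n d
    pres-init : ∀ e → initV (Inverse.to ψ e) ≡ Inverse.to φ (initV e)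
    pres-term : ∀ e → termV b (Inverse.to ψ e) ≡ Inverse.to φ (termV a e)
    pres-col  : ∀ e → colour (Inverse.to ψ e) ≡ colour e

σ : (n : ℕ) → .{{_ : NonZero n}} → ∀ {d} → PermFamily n d → Fin d → Fin n → Fin d → ℕ
σ n a j i k with k ≟ j
... | yes _ = n
... | no _  = (toℕ (a k ⟨$⟩ʳ i) + n ∸ toℕ i) % n

-- Δ^j_i(G_a) = σ^j(i,a_1) ⋯ σ^j(i,a_d)  (a string over {0,…,n}, one ℕ per character)
Δ : (n : ℕ) → .{{_ : NonZero n}} → ∀ {d} → PermFamily n d → Fin d → Fin n → List ℕ
Δ n {d} a j i = map (σ n a j i) (allFin d)

S : (n : ℕ) → .{{_ : NonZero n}} → ∀ {d} → PermFamily n d → Fin d → List ℕ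
S n a j = concatMap (Δ n a j) (allFin n)

CyclicallyEquivalent : List ℕ → List ℕ → Set
CyclicallyEquivalent κ κ′ = ∃₂ λ x y → κ ≡ x ++ y × κ′ ≡ y ++ x

module Submission where

-- Arcs are pairs (vertex, colour), so a colour-isomorphism is just a
-- vertex bijection f with b_k ∘ f = f ∘ a_k for all k.  Taking k = j, f commutes
-- with the n-cycle, hence f is a rotation of Z/n.  A rotation intertwines a and b
-- iff it preserves every letter σ^j, because σ^j(i, a_k) is the displacement
-- from i to a_k(i) and displacements are rotation invariant.  On strings,
-- "σ^j is preserved by a rotation by m blocks" says that S^j(G_b) is S^j(G_a)
-- shifted cyclically by m·d letters; and every cyclic shift relating the two
-- strings is by whole blocks, since the marker letter n sits exactly at the
-- offsets j of the blocks.

open import Defs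
open import Data.Nat using (ℕ; NonZero)
open import Data.Fin using (Fin)
open import Data.Product using (_×_)

open import Data.Nat.Base using (zero; suc; _+_; _*_; _∸_; _<_; _≤_; z≤n; s≤s; >-nonZero; >-nonZero⁻¹)
open import Data.Nat.Properties hiding (_≟_)
open import Data.Nat.DivMod
open import Data.Nat.Divisibility using (n∣m*n; m%n≡0⇒n∣m)
open import Data.Fin using (toℕ; fromℕ<; _≟_) renaming (zero to fzero; suc to fsuc)
open import Data.Fin.Properties using (toℕ-fromℕ<; toℕ-injective; toℕ<n)
open import Data.Fin.Permutation using (_⟨$⟩ʳ_)
open import Data.List.Base using (List; []; _∷_; _++_; length; concat; tabulate; take; drop)
open import Data.List.Properties using (length-++; length-take; length-tabulate; map-tabulate; take++drop≡id)
open import Data.Product using (∃; ∃₂; _,_)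
open import Data.Empty using (⊥-elim)
open import Function.Base using (id)
open import Function.Bundles using (_↔_; Inverse; mk↔ₛ′)
open import Function.Construct.Identity using (↔-id)
open import Data.Product.Function.NonDependent.Propositional using (_×-↔_)
open import Relation.Nullary using (¬_; yes; no)
open import Relation.Binary.PropositionalEquality
open ≡-Reasoning

%-absorbˡ : ∀ m k d .{{_ : NonZero d}} → (m % d + k) % d ≡ (m + k) % d
%-absorbˡ m k d = begin
  (m % d + k) % d          ≡⟨ %-distribˡ-+ (m % d) k d ⟩
  (m % d % d + k % d) % d  ≡⟨ cong (λ x → (x + k % d) % d) (m%n%n≡m%n m d) ⟩
  (m % d + k % d) % d      ≡⟨ sym (%-distribˡ-+ m k d) ⟩
  (m + k) % d              ∎

%-absorbʳ : ∀ m k d .{{_ : NonZero d}} → (m + k % d) % d ≡ (m + k) % d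
%-absorbʳ m k d = begin
  (m + k % d) % d  ≡⟨ cong (_% d) (+-comm m (k % d)) ⟩
  (k % d + m) % d  ≡⟨ %-absorbˡ k m d ⟩
  (k + m) % d      ≡⟨ cong (_% d) (+-comm k m) ⟩
  (m + k) % d      ∎

-- Rotations of the cycle Z/n, represented on Fin n.  'rotate 1' is the
-- standard n-cycle 'next n' of the statement (definitionally), and every
-- pair of vertices is joined by a unique rotation of amount below n.
module Rotation (n : ℕ) .{{_ : NonZero n}} where

  rotate : ℕ → Fin n → Fin n
  rotate r v = (r + toℕ v) mod n

  toℕ-rotate : ∀ r v → toℕ (rotate r v) ≡ (r + toℕ v) % n
  toℕ-rotate r v = toℕ-fromℕ< (m%n<n (r + toℕ v) n)

  rotate-rotate : ∀ r s v → rotate r (rotate s v) ≡ rotate (r + s) v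
  rotate-rotate r s v = toℕ-injective (begin
    toℕ (rotate r (rotate s v))  ≡⟨ toℕ-rotate r (rotate s v) ⟩
    (r + toℕ (rotate s v)) % n   ≡⟨ cong (λ x → (r + x) % n) (toℕ-rotate s v) ⟩
    (r + (s + toℕ v) % n) % n    ≡⟨ %-absorbʳ r (s + toℕ v) n ⟩
    (r + (s + toℕ v)) % n        ≡⟨ cong (_% n) (sym (+-assoc r s (toℕ v))) ⟩
    (r + s + toℕ v) % n          ≡⟨ sym (toℕ-rotate (r + s) v) ⟩
    toℕ (rotate (r + s) v)       ∎)

  rotate-comm : ∀ r s v → rotate r (rotate s v) ≡ rotate s (rotate r v)
  rotate-comm r s v = begin
    rotate r (rotate s v)  ≡⟨ rotate-rotate r s v ⟩
    rotate (r + s) v       ≡⟨ cong (λ x → rotate x v) (+-comm r s) ⟩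
    rotate (s + r) v       ≡⟨ sym (rotate-rotate s r v) ⟩
    rotate s (rotate r v)  ∎

  rotate-by-0 : ∀ v → rotate 0 v ≡ v
  rotate-by-0 v = toℕ-injective (trans (toℕ-rotate 0 v) (m<n⇒m%n≡m (toℕ<n v)))

  rotate-inverse : ∀ r s v → r + s ≡ n → rotate r (rotate s v) ≡ v
  rotate-inverse r s v r+s≡n = toℕ-injective (begin
    toℕ (rotate r (rotate s v))  ≡⟨ cong toℕ (rotate-rotate r s v) ⟩
    toℕ (rotate (r + s) v)       ≡⟨ toℕ-rotate (r + s) v ⟩
    (r + s + toℕ v) % n          ≡⟨ cong (λ x → (x + toℕ v) % n) r+s≡n ⟩
    (n + toℕ v) % n              ≡⟨ cong (_% n) (+-comm n (toℕ v)) ⟩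
    (toℕ v + n) % n              ≡⟨ [m+n]%n≡m%n (toℕ v) n ⟩
    toℕ v % n                    ≡⟨ m<n⇒m%n≡m (toℕ<n v) ⟩
    toℕ v                        ∎)

  origin : Fin n
  origin = 0 mod n

  toℕ-origin : toℕ origin ≡ 0
  toℕ-origin = trans (toℕ-fromℕ< (m%n<n 0 n)) (m<n⇒m%n≡m (>-nonZero⁻¹ n))

  toℕ-rotate-origin : ∀ s → toℕ (rotate s origin) ≡ s % n
  toℕ-rotate-origin s = begin
    toℕ (rotate s origin)    ≡⟨ toℕ-rotate s origin ⟩
    (s + toℕ origin) % n     ≡⟨ cong (λ x → (s + x) % n) toℕ-origin ⟩
    (s + 0) % n              ≡⟨ cong (_% n) (+-identityʳ s) ⟩
    s % n                    ∎

  rotate-to-origin : ∀ u → rotate (n ∸ toℕ u) u ≡ origin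
  rotate-to-origin u = toℕ-injective (begin
    toℕ (rotate (n ∸ toℕ u) u)  ≡⟨ toℕ-rotate (n ∸ toℕ u) u ⟩
    (n ∸ toℕ u + toℕ u) % n     ≡⟨ cong (_% n) (m∸n+n≡m (<⇒≤ (toℕ<n u))) ⟩
    n % n                       ≡⟨ n%n≡0 n ⟩
    0                           ≡⟨ sym toℕ-origin ⟩
    toℕ origin                  ∎)

  shift-cancel : ∀ s s′ u → rotate s u ≡ rotate s′ u → s % n ≡ s′ % n
  shift-cancel s s′ u eq = begin
    s % n                                ≡⟨ sym (toℕ-rotate-origin s) ⟩
    toℕ (rotate s origin)                ≡⟨ cong toℕ (via-u s) ⟩
    toℕ (rotate (n ∸ toℕ u) (rotate s u))  ≡⟨ cong (λ w → toℕ (rotate (n ∸ toℕ u) w)) eq ⟩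
    toℕ (rotate (n ∸ toℕ u) (rotate s′ u)) ≡⟨ cong toℕ (sym (via-u s′)) ⟩
    toℕ (rotate s′ origin)               ≡⟨ toℕ-rotate-origin s′ ⟩
    s′ % n                               ∎
    where
    via-u : ∀ x → rotate x origin ≡ rotate (n ∸ toℕ u) (rotate x u)
    via-u x = trans (cong (rotate x) (sym (rotate-to-origin u))) (rotate-comm x (n ∸ toℕ u) u)

  shift-injective : ∀ {s s′} u → s < n → s′ < n → rotate s u ≡ rotate s′ u → s ≡ s′
  shift-injective {s} {s′} u s<n s′<n eq =
    trans (sym (m<n⇒m%n≡m s<n)) (trans (shift-cancel s s′ u eq) (m<n⇒m%n≡m s′<n))

  -- disp u v is the amount of the unique rotation below n taking u to v.
  disp : Fin n → Fin n → ℕ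
  disp u v = (toℕ v + n ∸ toℕ u) % n

  disp<n : ∀ u v → disp u v < n
  disp<n u v = m%n<n (toℕ v + n ∸ toℕ u) n

  rotate-disp : ∀ u v → rotate (disp u v) u ≡ v
  rotate-disp u v = toℕ-injective (begin
    toℕ (rotate (disp u v) u)             ≡⟨ toℕ-rotate (disp u v) u ⟩
    ((toℕ v + n ∸ toℕ u) % n + toℕ u) % n ≡⟨ %-absorbˡ (toℕ v + n ∸ toℕ u) (toℕ u) n ⟩
    (toℕ v + n ∸ toℕ u + toℕ u) % n       ≡⟨ cong (_% n) (m∸n+n≡m u≤v+n) ⟩
    (toℕ v + n) % n                       ≡⟨ [m+n]%n≡m%n (toℕ v) n ⟩
    toℕ v % n                             ≡⟨ m<n⇒m%n≡m (toℕ<n v) ⟩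
    toℕ v                                 ∎)
    where
    u≤v+n : toℕ u ≤ toℕ v + n
    u≤v+n = ≤-trans (<⇒≤ (toℕ<n u)) (m≤n+m n (toℕ v))

  disp-unique : ∀ {s} u v → s < n → rotate s u ≡ v → disp u v ≡ s
  disp-unique u v s<n eq = shift-injective u (disp<n u v) s<n (trans (rotate-disp u v) (sym eq))

  disp-rotate : ∀ r u v → disp (rotate r u) (rotate r v) ≡ disp u v
  disp-rotate r u v = disp-unique (rotate r u) (rotate r v) (disp<n u v) (begin
    rotate (disp u v) (rotate r u)  ≡⟨ rotate-comm (disp u v) r u ⟩
    rotate r (rotate (disp u v) u)  ≡⟨ cong (rotate r) (rotate-disp u v) ⟩
    rotate r v                      ∎)

  commutes-with-rotations : (f : Fin n → Fin n) → (∀ v → f (rotate 1 v) ≡ rotate 1 (f v)) →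
    ∀ p v → f (rotate p v) ≡ rotate p (f v)
  commutes-with-rotations f comm zero v =
    trans (cong f (rotate-by-0 v)) (sym (rotate-by-0 (f v)))
  commutes-with-rotations f comm (suc p) v = begin
    f (rotate (suc p) v)           ≡⟨ cong f (sym (rotate-rotate 1 p v)) ⟩
    f (rotate 1 (rotate p v))      ≡⟨ comm (rotate p v) ⟩
    rotate 1 (f (rotate p v))      ≡⟨ cong (rotate 1) (commutes-with-rotations f comm p v) ⟩
    rotate 1 (rotate p (f v))      ≡⟨ rotate-rotate 1 p (f v) ⟩
    rotate (suc p) (f v)           ∎

  commuting-map-is-rotation : (f : Fin n → Fin n) → (∀ v → f (rotate 1 v) ≡ rotate 1 (f v)) →
    ∀ v → f v ≡ rotate (disp origin (f origin)) v
  commuting-map-is-rotation f comm v = begin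
    f v                                        ≡⟨ cong f (sym (rotate-disp origin v)) ⟩
    f (rotate p origin)                        ≡⟨ commutes-with-rotations f comm p origin ⟩
    rotate p (f origin)                        ≡⟨ cong (rotate p) (sym (rotate-disp origin (f origin))) ⟩
    rotate p (rotate c origin)                 ≡⟨ rotate-comm p c origin ⟩
    rotate c (rotate p origin)                 ≡⟨ cong (rotate c) (rotate-disp origin v) ⟩
    rotate c v                                 ∎
    where
    p c : ℕ
    p = disp origin v
    c = disp origin (f origin)

  rotation↔ : ∀ r → r ≤ n → Fin n ↔ Fin n
  rotation↔ r r≤n = mk↔ₛ′ (rotate r) (rotate (n ∸ r))
    (λ v → rotate-inverse r (n ∸ r) v (m+[n∸m]≡n r≤n))
    (λ v → rotate-inverse (n ∸ r) r v (m∸n+n≡m r≤n))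

  reindex : ∀ {ℓ} (P : Fin n → Fin n → Set ℓ) r m → r + m ≡ n →
    (∀ v → P (rotate r v) v) → ∀ q → P q (rotate m q)
  reindex P r m r+m≡n h q = subst (λ w → P w (rotate m q)) (rotate-inverse r m q r+m≡n) (h (rotate m q))

Intertwines : ∀ {n d} → PermFamily n d → PermFamily n d → (Fin n → Fin n) → Set
Intertwines a b f = ∀ v k → b k ⟨$⟩ʳ f v ≡ f (a k ⟨$⟩ʳ v)

intertwines-resp-≗ : ∀ {n d} {a b : PermFamily n d} {f g : Fin n → Fin n} →
  (∀ v → f v ≡ g v) → Intertwines a b f → Intertwines a b g
intertwines-resp-≗ {a = a} {b} f≗g int v k =
  trans (cong (b k ⟨$⟩ʳ_) (sym (f≗g v))) (trans (int v k) (f≗g (a k ⟨$⟩ʳ v)))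

-- Since arcs are pairs (vertex, colour), a colour-isomorphism is the same
-- thing as a vertex bijection intertwining the two families.
colorIso⇒intertwines : ∀ {n d} {a b : PermFamily n d} (iso : ColorIso a b) →
  Intertwines a b (Inverse.to (ColorIso.φ iso))
colorIso⇒intertwines {a = a} {b} iso v k = begin
  b k ⟨$⟩ʳ Inverse.to φ v     ≡⟨ cong (termV b) (sym (cong₂ _,_ (pres-init (v , k)) (pres-col (v , k)))) ⟩
  termV b (Inverse.to ψ (v , k)) ≡⟨ pres-term (v , k) ⟩
  Inverse.to φ (a k ⟨$⟩ʳ v)     ∎
  where
  open ColorIso iso

intertwines⇒colorIso : ∀ {n d} {a b : PermFamily n d} (φ : Fin n ↔ Fin n) →
  Intertwines a b (Inverse.to φ) → ColorIso a b
intertwines⇒colorIso {d = d} φ int = record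
  { φ = φ
  ; ψ = φ ×-↔ ↔-id (Fin d)
  ; pres-init = λ _ → refl
  ; pres-term = λ (v , k) → int v k
  ; pres-col = λ _ → refl
  }

module Steps (n d : ℕ) .{{_ : NonZero n}} (j : Fin d) where
  open Rotation n

  σ-self : (a : PermFamily n d) (i : Fin n) → σ n a j i j ≡ n
  σ-self a i with j ≟ j
  ... | yes _ = refl
  ... | no j≢j = ⊥-elim (j≢j refl)

  σ-other : (a : PermFamily n d) (i : Fin n) (k : Fin d) → ¬ k ≡ j → σ n a j i k ≡ disp i (a k ⟨$⟩ʳ i)
  σ-other a i k k≢j with k ≟ j
  ... | yes k≡j = ⊥-elim (k≢j k≡j)
  ... | no _ = refl

  σ-marker : (a : PermFamily n d) (i : Fin n) (k : Fin d) → σ n a j i k ≡ n → k ≡ j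
  σ-marker a i k σ≡n with k ≟ j
  ... | yes k≡j = k≡j
  ... | no _ = ⊥-elim (<-irrefl σ≡n (disp<n i (a k ⟨$⟩ʳ i)))

  colour-cases : ∀ {ℓ} (P : Fin d → Set ℓ) → P j → (∀ k → ¬ k ≡ j → P k) → ∀ k → P k
  colour-cases P at-j elsewhere k with k ≟ j
  ... | yes refl = at-j
  ... | no k≢j = elsewhere k k≢j

  intertwining⇒σ-preserved : (a b : PermFamily n d) (r : ℕ) → Intertwines a b (rotate r) →
    ∀ v k → σ n b j (rotate r v) k ≡ σ n a j v k
  intertwining⇒σ-preserved a b r int v =
    colour-cases (λ k → σ n b j (rotate r v) k ≡ σ n a j v k)
      (trans (σ-self b (rotate r v)) (sym (σ-self a v)))
      λ k k≢j → begin
        σ n b j (rotate r v) k                     ≡⟨ σ-other b (rotate r v) k k≢j ⟩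
        disp (rotate r v) (b k ⟨$⟩ʳ rotate r v)    ≡⟨ cong (disp (rotate r v)) (int v k) ⟩
        disp (rotate r v) (rotate r (a k ⟨$⟩ʳ v))  ≡⟨ disp-rotate r v (a k ⟨$⟩ʳ v) ⟩
        disp v (a k ⟨$⟩ʳ v)                        ≡⟨ sym (σ-other a v k k≢j) ⟩
        σ n a j v k                                ∎

  σ-preserved⇒intertwining : (a b : PermFamily n d) (r : ℕ) → IsStdCycle (a j) → IsStdCycle (b j) →
    (∀ v k → σ n b j (rotate r v) k ≡ σ n a j v k) → Intertwines a b (rotate r)
  σ-preserved⇒intertwining a b r a-cycle b-cycle same v =
    colour-cases (λ k → b k ⟨$⟩ʳ rotate r v ≡ rotate r (a k ⟨$⟩ʳ v)) colour-j other-colour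
    where
    -- at colour j both families are rotate 1, which commutes with rotate r
    colour-j : b j ⟨$⟩ʳ rotate r v ≡ rotate r (a j ⟨$⟩ʳ v)
    colour-j = begin
      b j ⟨$⟩ʳ rotate r v    ≡⟨ b-cycle (rotate r v) ⟩
      rotate 1 (rotate r v)  ≡⟨ rotate-comm 1 r v ⟩
      rotate r (rotate 1 v)  ≡⟨ cong (rotate r) (sym (a-cycle v)) ⟩
      rotate r (a j ⟨$⟩ʳ v)  ∎

    -- elsewhere both arcs have the same displacement s, and rotations commute
    other-colour : ∀ k → ¬ k ≡ j → b k ⟨$⟩ʳ rotate r v ≡ rotate r (a k ⟨$⟩ʳ v)
    other-colour k k≢j = begin
      b k ⟨$⟩ʳ rotate r v     ≡⟨ sym (rotate-disp (rotate r v) (b k ⟨$⟩ʳ rotate r v)) ⟩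
      rotate s′ (rotate r v)  ≡⟨ cong (λ x → rotate x (rotate r v)) s′≡s ⟩
      rotate s (rotate r v)   ≡⟨ rotate-comm s r v ⟩
      rotate r (rotate s v)   ≡⟨ cong (rotate r) (rotate-disp v (a k ⟨$⟩ʳ v)) ⟩
      rotate r (a k ⟨$⟩ʳ v)   ∎
      where
      s s′ : ℕ
      s  = disp v (a k ⟨$⟩ʳ v)
      s′ = disp (rotate r v) (b k ⟨$⟩ʳ rotate r v)
      s′≡s : s′ ≡ s
      s′≡s = trans (sym (σ-other b (rotate r v) k k≢j)) (trans (same v k) (σ-other a v k k≢j))

  intertwiner-commutes : (a b : PermFamily n d) (f : Fin n → Fin n) → IsStdCycle (a j) → IsStdCycle (b j) →
    Intertwines a b f → ∀ v → f (rotate 1 v) ≡ rotate 1 (f v)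
  intertwiner-commutes a b f a-cycle b-cycle int v =
    trans (cong f (sym (a-cycle v))) (trans (sym (int v j)) (b-cycle (f v)))

-- Positional access to a string; the value past the end is irrelevant.
at : List ℕ → ℕ → ℕ
at []       _       = 0
at (c ∷ cs) zero    = c
at (c ∷ cs) (suc p) = at cs p

at-++ˡ : ∀ xs ys p → p < length xs → at (xs ++ ys) p ≡ at xs p
at-++ˡ (x ∷ xs) ys zero    _         = refl
at-++ˡ (x ∷ xs) ys (suc p) (s≤s p<) = at-++ˡ xs ys p p<

at-++ʳ : ∀ xs ys p → at (xs ++ ys) (length xs + p) ≡ at ys p
at-++ʳ []       ys p = refl
at-++ʳ (x ∷ xs) ys p = at-++ʳ xs ys p

at-extensional : ∀ xs ys → length xs ≡ length ys → (∀ p → p < length xs → at xs p ≡ at ys p) → xs ≡ ys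
at-extensional []       []       _   _    = refl
at-extensional (x ∷ xs) (y ∷ ys) len same =
  cong₂ _∷_ (same 0 (s≤s z≤n)) (at-extensional xs ys (suc-injective len) (λ p p< → same (suc p) (s≤s p<)))

at-tabulate : ∀ {m} (f : Fin m → ℕ) (k : Fin m) → at (tabulate f) (toℕ k) ≡ f k
at-tabulate f fzero    = refl
at-tabulate f (fsuc k) = at-tabulate (λ i → f (fsuc i)) k

length-blocks : ∀ {m} d (B : Fin m → List ℕ) → (∀ i → length (B i) ≡ d) →
  length (concat (tabulate B)) ≡ m * d
length-blocks {zero}  d B len = refl
length-blocks {suc m} d B len =
  trans (length-++ (B fzero)) (cong₂ _+_ (len fzero) (length-blocks d (λ i → B (fsuc i)) (λ i → len (fsuc i))))

at-blocks : ∀ {m} d (B : Fin m → List ℕ) → (∀ i → length (B i) ≡ d) →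
  ∀ i k → k < d → at (concat (tabulate B)) (toℕ i * d + k) ≡ at (B i) k
at-blocks d B len fzero    k k<d = at-++ˡ (B fzero) _ k (subst (k <_) (sym (len fzero)) k<d)
at-blocks d B len (fsuc i) k k<d = begin
  at (B fzero ++ rest) (d + toℕ i * d + k)               ≡⟨ cong (at (B fzero ++ rest)) position ⟩
  at (B fzero ++ rest) (length (B fzero) + (toℕ i * d + k)) ≡⟨ at-++ʳ (B fzero) rest (toℕ i * d + k) ⟩
  at rest (toℕ i * d + k)                                ≡⟨ at-blocks d (λ i → B (fsuc i)) (λ i → len (fsuc i)) i k k<d ⟩
  at (B (fsuc i)) k                                      ∎
  where
  rest : List ℕ
  rest = concat (tabulate (λ i → B (fsuc i)))
  position : d + toℕ i * d + k ≡ length (B fzero) + (toℕ i * d + k)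
  position = trans (+-assoc d (toℕ i * d) k) (cong (_+ (toℕ i * d + k)) (sym (len fzero)))

at-swap : ∀ N .{{_ : NonZero N}} xs ys → length xs + length ys ≡ N →
  ∀ p → p < N → at (ys ++ xs) p ≡ at (xs ++ ys) ((p + length xs) % N)
at-swap N xs ys len p p<N with p <? length ys
... | yes p<ys = begin
  at (ys ++ xs) p                    ≡⟨ at-++ˡ ys xs p p<ys ⟩
  at ys p                            ≡⟨ sym (at-++ʳ xs ys p) ⟩
  at (xs ++ ys) (length xs + p)      ≡⟨ cong (at (xs ++ ys)) offset ⟩
  at (xs ++ ys) ((p + length xs) % N) ∎
  where
  offset : length xs + p ≡ (p + length xs) % N
  offset = sym (trans (m<n⇒m%n≡m (subst (p + length xs <_) (trans (+-comm (length ys) (length xs)) len)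
                                     (+-monoˡ-< (length xs) p<ys)))
                      (+-comm p (length xs)))
... | no p≮ys = begin
  at (ys ++ xs) p                    ≡⟨ cong (at (ys ++ xs)) (sym p≡ys+q) ⟩
  at (ys ++ xs) (length ys + q)      ≡⟨ at-++ʳ ys xs q ⟩
  at xs q                            ≡⟨ sym (at-++ˡ xs ys q q<xs) ⟩
  at (xs ++ ys) q                    ≡⟨ cong (at (xs ++ ys)) offset ⟩
  at (xs ++ ys) ((p + length xs) % N) ∎
  where
  q : ℕ
  q = p ∸ length ys
  p≡ys+q : length ys + q ≡ p
  p≡ys+q = m+[n∸m]≡n (≮⇒≥ p≮ys)
  q<xs : q < length xs
  q<xs = +-cancelˡ-< (length ys) q (length xs)
           (subst₂ _<_ (sym p≡ys+q) (trans (sym len) (+-comm (length xs) (length ys))) p<N)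
  offset : q ≡ (p + length xs) % N
  offset = sym (begin
    (p + length xs) % N              ≡⟨ cong (λ x → (x + length xs) % N) (sym p≡ys+q) ⟩
    (length ys + q + length xs) % N  ≡⟨ cong (_% N) (arrange (length ys) q (length xs)) ⟩
    (q + (length xs + length ys)) % N ≡⟨ cong (λ x → (q + x) % N) len ⟩
    (q + N) % N                      ≡⟨ [m+n]%n≡m%n q N ⟩
    q % N                            ≡⟨ m<n⇒m%n≡m (<-≤-trans q<xs (subst (length xs ≤_) len (m≤m+n (length xs) (length ys)))) ⟩
    q                                ∎)
    where
    arrange : ∀ y q x → y + q + x ≡ q + (x + y)
    arrange y q x = trans (cong (_+ x) (+-comm y q)) (trans (+-assoc q y x) (cong (q +_) (+-comm y x)))

block-decomposition : ∀ n d .{{_ : NonZero d}} P → P < n * d →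
  ∃₂ λ (i : Fin n) (k : Fin d) → P ≡ toℕ i * d + toℕ k
block-decomposition n d P P<nd = fromℕ< i<n , fromℕ< (m%n<n P d) , (begin
  P                  ≡⟨ m≡m%n+[m/n]*n P d ⟩
  P % d + P / d * d  ≡⟨ +-comm (P % d) (P / d * d) ⟩
  P / d * d + P % d  ≡⟨ sym (cong₂ (λ i k → i * d + k) (toℕ-fromℕ< i<n) (toℕ-fromℕ< (m%n<n P d))) ⟩
  toℕ (fromℕ< i<n) * d + toℕ (fromℕ< (m%n<n P d)) ∎)
  where
  i<n : P / d < n
  i<n = m<n*o⇒m/o<n {P} {n} {d} P<nd

block-position< : ∀ {n} d (i : Fin n) k → k < d → toℕ i * d + k < n * d
block-position< {n} d i k k<d =
  -- i·d + k < i·d + d = (i + 1)·d ≤ n·d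
  <-≤-trans (+-monoʳ-< (toℕ i * d) k<d)
            (≤-trans (≤-reflexive (+-comm (toℕ i * d) d)) (*-monoˡ-≤ d (toℕ<n i)))

block-offset : ∀ c d .{{_ : NonZero d}} k → k < d → (c * d + k) % d ≡ k
block-offset c d k k<d = trans (cong (_% d) (+-comm (c * d) k)) (trans ([m+kn]%n≡m%n k c d) (m<n⇒m%n≡m k<d))

module Strings (n d : ℕ) .{{_ : NonZero n}} (j : Fin d) where
  open Rotation n
  open Steps n d j

  instance
    d≢0 : NonZero d
    d≢0 = >-nonZero (≤-<-trans z≤n (toℕ<n j))

    nd≢0 : NonZero (n * d)
    nd≢0 = m*n≢0 n d

  S-as-blocks : (a : PermFamily n d) → S n a j ≡ concat (tabulate (Δ n a j))
  S-as-blocks a = cong concat (map-tabulate id (Δ n a j))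

  length-Δ : (a : PermFamily n d) (i : Fin n) → length (Δ n a j i) ≡ d
  length-Δ a i = trans (cong length (map-tabulate id (σ n a j i))) (length-tabulate (σ n a j i))

  length-S : (a : PermFamily n d) → length (S n a j) ≡ n * d
  length-S a = trans (cong length (S-as-blocks a)) (length-blocks d (Δ n a j) (length-Δ a))

  at-S : (a : PermFamily n d) (i : Fin n) (k : Fin d) → at (S n a j) (toℕ i * d + toℕ k) ≡ σ n a j i k
  at-S a i k = begin
    at (S n a j) (toℕ i * d + toℕ k)                     ≡⟨ cong (λ L → at L (toℕ i * d + toℕ k)) (S-as-blocks a) ⟩
    at (concat (tabulate (Δ n a j))) (toℕ i * d + toℕ k) ≡⟨ at-blocks d (Δ n a j) (length-Δ a) i (toℕ k) (toℕ<n k) ⟩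
    at (Δ n a j i) (toℕ k)                               ≡⟨ cong (λ L → at L (toℕ k)) (map-tabulate id (σ n a j i)) ⟩
    at (tabulate (σ n a j i)) (toℕ k)                    ≡⟨ at-tabulate (σ n a j i) k ⟩
    σ n a j i k                                          ∎

  ShiftedBy : ℕ → PermFamily n d → PermFamily n d → Set
  ShiftedBy t a b = ∀ P → P < n * d → at (S n b j) P ≡ at (S n a j) ((P + t) % (n * d))

  cyclic⇒shifted : (a b : PermFamily n d) → CyclicallyEquivalent (S n a j) (S n b j) →
    ∃ λ t → t ≤ n * d × ShiftedBy t a b
  cyclic⇒shifted a b (x , y , Sa≡xy , Sb≡yx) = length x , subst (length x ≤_) len (m≤m+n (length x) (length y)) ,
    λ P P<nd → begin
      at (S n b j) P                          ≡⟨ cong (λ L → at L P) Sb≡yx ⟩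
      at (y ++ x) P                           ≡⟨ at-swap (n * d) x y len P P<nd ⟩
      at (x ++ y) ((P + length x) % (n * d))  ≡⟨ cong (λ L → at L ((P + length x) % (n * d))) (sym Sa≡xy) ⟩
      at (S n a j) ((P + length x) % (n * d)) ∎
    where
    len : length x + length y ≡ n * d
    len = trans (sym (length-++ x)) (trans (cong length (sym Sa≡xy)) (length-S a))

  shifted⇒cyclic : (a b : PermFamily n d) (t : ℕ) → t ≤ n * d → ShiftedBy t a b →
    CyclicallyEquivalent (S n a j) (S n b j)
  shifted⇒cyclic a b t t≤nd shifted = x , y , sym Sa≡xy , at-extensional (S n b j) (y ++ x) lengths pointwise
    where
    x y : List ℕ
    x = take t (S n a j)
    y = drop t (S n a j)
    Sa≡xy : x ++ y ≡ S n a j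
    Sa≡xy = take++drop≡id t (S n a j)
    |x|≡t : length x ≡ t
    |x|≡t = trans (length-take t (S n a j)) (m≤n⇒m⊓n≡m (subst (t ≤_) (sym (length-S a)) t≤nd))
    len : length x + length y ≡ n * d
    len = trans (sym (length-++ x)) (trans (cong length Sa≡xy) (length-S a))
    lengths : length (S n b j) ≡ length (y ++ x)
    lengths = trans (length-S b) (trans (sym len) (trans (+-comm (length x) (length y)) (sym (length-++ y))))
    pointwise : ∀ P → P < length (S n b j) → at (S n b j) P ≡ at (y ++ x) P
    pointwise P P< = begin
      at (S n b j) P                          ≡⟨ shifted P P<nd ⟩
      at (S n a j) ((P + t) % (n * d))        ≡⟨ cong₂ (λ L s → at L ((P + s) % (n * d))) (sym Sa≡xy) (sym |x|≡t) ⟩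
      at (x ++ y) ((P + length x) % (n * d))  ≡⟨ sym (at-swap (n * d) x y len P P<nd) ⟩
      at (y ++ x) P                           ∎
      where
      P<nd : P < n * d
      P<nd = subst (P <_) (length-S b) P<

  marker-offset : (a : PermFamily n d) (P : ℕ) → P < n * d → at (S n a j) P ≡ n → P % d ≡ toℕ j
  marker-offset a P P<nd marker with block-decomposition n d P P<nd
  ... | q , k , refl = begin
    (toℕ q * d + toℕ k) % d  ≡⟨ block-offset (toℕ q) d (toℕ k) (toℕ<n k) ⟩
    toℕ k                    ≡⟨ cong toℕ (σ-marker a q k (trans (sym (at-S a q k)) marker)) ⟩
    toℕ j                    ∎

  -- Hence a cyclic shift carrying one string to the other moves the marker
  -- of a block to the marker of a block: it shifts by whole blocks.
  shift-multiple-of-d : (a b : PermFamily n d) (t : ℕ) → ShiftedBy t a b → t % d ≡ 0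
  shift-multiple-of-d a b t shifted = begin
    t % d  ≡⟨ Rd.shift-cancel t 0 j (trans (toℕ-injective offset) (sym (Rd.rotate-by-0 j))) ⟩
    0 % d  ≡⟨ m<n⇒m%n≡m (>-nonZero⁻¹ d) ⟩
    0      ∎
    where
    module Rd = Rotation d
    P₀ P₁ : ℕ
    P₀ = toℕ origin * d + toℕ j
    P₁ = (P₀ + t) % (n * d)
    marker-at-P₁ : at (S n a j) P₁ ≡ n
    marker-at-P₁ = trans (sym (shifted P₀ (block-position< d origin (toℕ j) (toℕ<n j))))
                         (trans (at-S b origin j) (σ-self b origin))
    arrange : ∀ t x y → t + x + y ≡ y + x + t
    arrange t x y = trans (+-comm (t + x) y) (trans (cong (y +_) (+-comm t x)) (sym (+-assoc y x t)))
    offset : toℕ (Rd.rotate t j) ≡ toℕ j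
    offset = begin
      toℕ (Rd.rotate t j)               ≡⟨ Rd.toℕ-rotate t j ⟩
      (t + toℕ j) % d                   ≡⟨ sym ([m+kn]%n≡m%n (t + toℕ j) (toℕ origin) d) ⟩
      (t + toℕ j + toℕ origin * d) % d  ≡⟨ cong (_% d) (arrange t (toℕ j) (toℕ origin * d)) ⟩
      (P₀ + t) % d                      ≡⟨ sym (m∣n⇒o%n%m≡o%m d (n * d) (P₀ + t) (n∣m*n n)) ⟩
      P₁ % d                            ≡⟨ marker-offset a P₁ (m%n<n (P₀ + t) (n * d)) marker-at-P₁ ⟩
      toℕ j                             ∎

  whole-blocks : (a b : PermFamily n d) (t : ℕ) → t ≤ n * d → ShiftedBy t a b → ∃ λ m → m ≤ n × t ≡ m * d
  whole-blocks a b t t≤nd shifted =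
    t / d ,
    ≤-trans (/-monoˡ-≤ d t≤nd) (≤-reflexive (m*n/n≡m n d)) ,
    sym (m/n*n≡m (m%n≡0⇒n∣m t d (shift-multiple-of-d a b t shifted)))

  block-shift : (m : ℕ) (i : Fin n) (k : Fin d) →
    (toℕ i * d + toℕ k + m * d) % (n * d) ≡ toℕ (rotate m i) * d + toℕ k
  block-shift m i k = begin
    (toℕ i * d + toℕ k + m * d) % (n * d)  ≡⟨ cong (_% (n * d)) arrange ⟩
    ((m + toℕ i) * d + toℕ k) % (n * d)    ≡⟨ [m*n+o]%[p*n]≡[m*n]%[p*n]+o (m + toℕ i) n (toℕ<n k) ⟩
    (m + toℕ i) * d % (n * d) + toℕ k      ≡⟨ cong (_+ toℕ k) (sym (m%n*o≡m*o%[n*o] (m + toℕ i) n d)) ⟩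
    (m + toℕ i) % n * d + toℕ k            ≡⟨ cong (λ x → x * d + toℕ k) (sym (toℕ-rotate m i)) ⟩
    toℕ (rotate m i) * d + toℕ k           ∎
    where
    arrange : toℕ i * d + toℕ k + m * d ≡ (m + toℕ i) * d + toℕ k
    arrange = begin
      toℕ i * d + toℕ k + m * d    ≡⟨ +-assoc (toℕ i * d) (toℕ k) (m * d) ⟩
      toℕ i * d + (toℕ k + m * d)  ≡⟨ cong (toℕ i * d +_) (+-comm (toℕ k) (m * d)) ⟩
      toℕ i * d + (m * d + toℕ k)  ≡⟨ sym (+-assoc (toℕ i * d) (m * d) (toℕ k)) ⟩
      toℕ i * d + m * d + toℕ k    ≡⟨ cong (_+ toℕ k) (trans (+-comm (toℕ i * d) (m * d)) (sym (*-distribʳ-+ d m (toℕ i)))) ⟩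
      (m + toℕ i) * d + toℕ k      ∎

  BlockRotated : ℕ → PermFamily n d → PermFamily n d → Set
  BlockRotated m a b = ∀ i k → σ n b j i k ≡ σ n a j (rotate m i) k

  shifted-block : (a : PermFamily n d) (m : ℕ) (i : Fin n) (k : Fin d) →
    at (S n a j) ((toℕ i * d + toℕ k + m * d) % (n * d)) ≡ σ n a j (rotate m i) k
  shifted-block a m i k = trans (cong (at (S n a j)) (block-shift m i k)) (at-S a (rotate m i) k)

  shifted⇒block-rotated : (a b : PermFamily n d) (m : ℕ) → ShiftedBy (m * d) a b → BlockRotated m a b
  shifted⇒block-rotated a b m shifted i k = begin
    σ n b j i k                                           ≡⟨ sym (at-S b i k) ⟩
    at (S n b j) (toℕ i * d + toℕ k)                      ≡⟨ shifted _ (block-position< d i (toℕ k) (toℕ<n k)) ⟩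
    at (S n a j) ((toℕ i * d + toℕ k + m * d) % (n * d))  ≡⟨ shifted-block a m i k ⟩
    σ n a j (rotate m i) k                                ∎

  block-rotated⇒shifted : (a b : PermFamily n d) (m : ℕ) → BlockRotated m a b → ShiftedBy (m * d) a b
  block-rotated⇒shifted a b m rotated P P<nd with block-decomposition n d P P<nd
  ... | i , k , refl = begin
    at (S n b j) (toℕ i * d + toℕ k)                      ≡⟨ at-S b i k ⟩
    σ n b j i k                                           ≡⟨ rotated i k ⟩
    σ n a j (rotate m i) k                                ≡⟨ sym (shifted-block a m i k) ⟩
    at (S n a j) ((toℕ i * d + toℕ k + m * d) % (n * d))  ∎

module Correspondence (n d : ℕ) .{{_ : NonZero n}} (j : Fin d) (a b : PermFamily n d)
                      (a-cycle : IsStdCycle (a j)) (b-cycle : IsStdCycle (b j)) where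
  open Rotation n
  open Steps n d j
  open Strings n d j

  -- The vertex map of a colour-isomorphism is a rotation by some c < n; it
  -- preserves σ^j, so S^j(G_b) is S^j(G_a) shifted by n - c blocks.
  isomorphic⇒cyclic : ColorIso a b → CyclicallyEquivalent (S n a j) (S n b j)
  isomorphic⇒cyclic iso = shifted⇒cyclic a b (m * d) (*-monoˡ-≤ d (m∸n≤m n c)) (block-rotated⇒shifted a b m rotated)
    where
    f : Fin n → Fin n
    f = Inverse.to (ColorIso.φ iso)
    c m : ℕ
    c = disp origin (f origin)
    m = n ∸ c
    f-is-rotation : ∀ v → f v ≡ rotate c v
    f-is-rotation = commuting-map-is-rotation f (intertwiner-commutes a b f a-cycle b-cycle (colorIso⇒intertwines iso))
    preserved : ∀ v k → σ n b j (rotate c v) k ≡ σ n a j v k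
    preserved = intertwining⇒σ-preserved a b c (intertwines-resp-≗ {a = a} {b = b} f-is-rotation (colorIso⇒intertwines iso))
    rotated : BlockRotated m a b
    rotated = reindex (λ i w → ∀ k → σ n b j i k ≡ σ n a j w k) c m (m+[n∸m]≡n (<⇒≤ (disp<n origin (f origin)))) preserved

  -- Conversely a cyclic shift is by m ≤ n whole blocks, and the rotation by
  -- n - m then preserves σ^j, hence intertwines a and b.
  cyclic⇒isomorphic : CyclicallyEquivalent (S n a j) (S n b j) → ColorIso a b
  cyclic⇒isomorphic cyc with cyclic⇒shifted a b cyc
  ... | t , t≤nd , shifted with whole-blocks a b t t≤nd shifted
  ... | m , m≤n , refl =
    intertwines⇒colorIso (rotation↔ r (m∸n≤m n m)) (σ-preserved⇒intertwining a b r a-cycle b-cycle preserved)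
    where
    r : ℕ
    r = n ∸ m
    preserved : ∀ v k → σ n b j (rotate r v) k ≡ σ n a j v k
    preserved = reindex (λ w i → ∀ k → σ n b j i k ≡ σ n a j w k) m r (m+[n∸m]≡n m≤n) (shifted⇒block-rotated a b m shifted)

proposition2 : (n d : ℕ) → .{{_ : NonZero n}} → (a b : PermFamily n d) → (j : Fin d) →
    IsStdCycle (a j) → IsStdCycle (b j) →
    (ColorIso a b → CyclicallyEquivalent (S n a j) (S n b j)) ×
    (CyclicallyEquivalent (S n a j) (S n b j) → ColorIso a b)
proposition2 n d a b j a-cycle b-cycle = isomorphic⇒cyclic , cyclic⇒isomorphic
  where open Correspondence n d j a b a-cycle b-cycle
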